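{- Let $G$ be a separated $(1,1)$-critical graph. Then the maximum degree of $G$ is less than $6$.
   Context: Two edges $uv$, $xy$ ($u\prec v$, $x\prec y$, four distinct endpoints) of an ordered graph cross if $u\prec x\prec v\prec y$ or $x\prec u\prec y\prec v$ and nest if $u\prec x\prec y\prec v$ or $x\prec u\prec v\prec y$. A stack (queue) is an edge set with no two crossing (nesting) edges; a $1$-stack $1$-queue layout is a partition of the edges into one stack and one queue with respect to the given order. A separated graph is a bipartite graph with bipartition $V_1\cup V_2$ ordered so that all of $V_1$ precedes all of $V_2$. $G$ is $(1,1)$-critical if it has no $1$-stack $1$-queue layout but $G-e$ has one for every edge $e$. -}

module Defs where

open import Data.Nat using (ℕ; _<_; _≤_)
open import Data.Fin using (Fin; toℕ; _≟_)
open import Data.Bool using (Bool; true; false; _∧_; _∨_; not)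
open import Data.List using (length; filter; allFin)
open import Data.Product using (Σ; _×_; _,_)
open import Data.Empty using (⊥)
open import Relation.Nullary using (¬_)
open import Relation.Nullary.Decidable using (⌊_⌋)
open import Relation.Binary.PropositionalEquality using (_≡_)
open import Data.Fin using () renaming (_<_ to _≺_)

-- An ordered graph on vertices Fin n, vertex order = the natural order of Fin n.
-- Edges are encoded by E u v = true with u ≺ v; values of E on pairs with
-- ¬ (u ≺ v) are irrelevant (ignored everywhere below).
OGraph : ℕ → Set
OGraph n = Fin n → Fin n → Bool

IsEdge : ∀ {n} → OGraph n → Fin n → Fin n → Set
IsEdge E u v = (u ≺ v) × (E u v ≡ true)

Cross : ∀ {n} → Fin n → Fin n → Fin n → Fin n → Set
Cross u v x y = (u ≺ x × x ≺ v × v ≺ y) ⊎' (x ≺ u × u ≺ y × y ≺ v)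
  where
  open import Data.Sum using () renaming (_⊎_ to _⊎'_)

Nest : ∀ {n} → Fin n → Fin n → Fin n → Fin n → Set
Nest u v x y = (u ≺ x × x ≺ y × y ≺ v) ⊎' (x ≺ u × u ≺ v × v ≺ y)
  where
  open import Data.Sum using () renaming (_⊎_ to _⊎'_)

-- A 1-stack 1-queue layout: a colouring of the edges (true = stack,
-- false = queue) such that no two stack edges cross and no two queue edges nest.
-- (Strict inequalities in Cross/Nest force the four endpoints to be distinct.)
record Layout11 {n} (E : OGraph n) : Set where
  field
    inStack : Fin n → Fin n → Bool
    stackOK : ∀ u v x y → IsEdge E u v → IsEdge E x y →
              inStack u v ≡ true → inStack x y ≡ true → ¬ Cross u v x y
    queueOK : ∀ u v x y → IsEdge E u v → IsEdge E x y →
              inStack u v ≡ false → inStack x y ≡ false → ¬ Nest u v x y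

HasLayout11 : ∀ {n} → OGraph n → Set
HasLayout11 E = Layout11 E

deleteEdge : ∀ {n} → OGraph n → Fin n → Fin n → OGraph n
deleteEdge E u v x y = E x y ∧ not (⌊ x ≟ u ⌋ ∧ ⌊ y ≟ v ⌋)

Critical11 : ∀ {n} → OGraph n → Set
Critical11 E = ¬ HasLayout11 E × (∀ u v → IsEdge E u v → HasLayout11 (deleteEdge E u v))

Separated : ∀ {n} → OGraph n → Set
Separated {n} E = Σ ℕ λ k → ∀ u v → IsEdge E u v → (toℕ u < k) × (k ≤ toℕ v)

adj : ∀ {n} → OGraph n → Fin n → Fin n → Bool
adj E v w = (⌊ v Data.Fin.<? w ⌋ ∧ E v w) ∨ (⌊ w Data.Fin.<? v ⌋ ∧ E w v)
  where import Data.Fin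

degree : ∀ {n} → OGraph n → Fin n → ℕ
degree {n} E v = length (filter (λ w → Data.Bool._≟_ (adj E v w) true) (allFin n))
  where import Data.Bool

MaxDegreeLess : ∀ {n} → OGraph n → ℕ → Set
MaxDegreeLess E d = ∀ v → degree E v < d

-- Edges of a separated graph are points (u , v) of the grid V₁ × V₂: two edges cross when
-- their points increase in both coordinates and nest when one coordinate increases while the
-- other decreases, so reversing the order of V₁ exchanges stacks and queues. Let u ∈ V₁ have
-- neighbours c₁ < … < c₆ and take, by criticality, layouts of G − uc₂ and G − uc₅ (a vertex
-- of V₂ is handled by exchanging V₁ and V₂). Since uc₂ fits neither into the stack nor into
-- the queue, the edges at u switch from stack to queue at c₂ or the other way round, and some
-- queue edge before u and beyond c₂ blocks uc₂; likewise at c₅. Two switches in the same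
-- direction combine into a layout of G: at the vertices of V₁ before u the edges beyond c₃ are
-- stack edges of the first layout and the others queue edges of the second, at u the switch
-- moves to c₃, and after u the first layout is kept. For switches in opposite directions, the
-- blocker at c₂ can be coloured neither way in the layout of G − uc₅.

module Submission where

open import Defs
open import Data.Bool using (Bool; true; false; not; _∧_; T; if_then_else_)
import Data.Bool as Bool
open import Data.Bool.Properties using (not-injective; not-¬; T-≡; T-∧; T-∨)
open import Data.Empty using (⊥; ⊥-elim)
open import Data.Fin using (Fin; toℕ; _<_; _≤_; _<?_)
import Data.Fin as Fin
import Data.Fin.Properties as Finₚ
open import Data.List using (List; []; _∷_; length; filter; allFin)
open import Data.List.Relation.Unary.All as All using (All; _∷_)
import Data.List.Relation.Unary.All.Properties as Allₚ
open import Data.List.Relation.Unary.AllPairs using (AllPairs; _∷_)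
import Data.List.Relation.Unary.AllPairs.Properties as AllPairsₚ
open import Data.Nat using (ℕ; s≤s)
import Data.Nat as ℕ
import Data.Nat.Properties as ℕₚ
open import Data.Product using (∃; _×_; _,_; proj₁; proj₂; swap)
open import Data.Product.Properties using (≡-dec)
import Data.Product as Product
open import Data.Sum using (_⊎_; inj₁; inj₂)
import Data.Sum as Sum
open import Function using (_∘_; flip; id)
open import Level using (0ℓ)
open import Relation.Binary
  using (Rel; IsStrictTotalOrder; Irreflexive; Symmetric; DecidableEquality; tri<; tri≈; tri>)
import Relation.Binary.Construct.Flip.EqAndOrd as Flip
open import Relation.Binary.PropositionalEquality using (_≡_; _≢_; refl; sym; trans; cong; ≢-sym)
open import Relation.Nullary using (¬_; Dec; yes; no; does)
open import Relation.Nullary.Decidable using (⌊_⌋; dec-true; dec-false; toWitness)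
open import Relation.Unary using (Pred; _∈_; _∉_; _⊆_; _∩_; _∖_; ｛_｝; Decidable)
open import Function.Bundles using (Equivalence)
open Equivalence using (to; from)

does-true : ∀ {X : Set} (x? : Dec X) → does x? ≡ true → X
does-true (yes x) _ = x
does-true (no _) ()

does-false : ∀ {X : Set} (x? : Dec X) → does x? ≡ false → ¬ X
does-false (no ¬x) _ = ¬x
does-false (yes _) ()

-- Independent of the order of the rows, hence shared by a grid and its reverse.
module Points {A : Set} (n : ℕ) where

  Point : Set
  Point = A × Fin n

  _without_ : Pred Point 0ℓ → Point → Pred Point 0ℓ
  P without p = P ∖ ｛ p ｝

  private variable
    P : Pred Point 0ℓ
    a u : A
    b c : Fin n

  ∉-row : a ≢ u → (a , b) ∉ ｛ u , c ｝
  ∉-row a≢u = a≢u ∘ sym ∘ cong proj₁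

  ∉-col : b ≢ c → (u , b) ∉ ｛ u , c ｝
  ∉-col b≢c = b≢c ∘ sym ∘ cong proj₂

  record SixInRow (P : Pred Point 0ℓ) (u : A) : Set where
    field
      c₁ c₂ c₃ c₄ c₅ c₆ : Fin n
      c₁<c₂ : c₁ < c₂
      c₂<c₃ : c₂ < c₃
      c₃<c₄ : c₃ < c₄
      c₄<c₅ : c₄ < c₅
      c₅<c₆ : c₅ < c₆
      ∈₁ : (u , c₁) ∈ P
      ∈₂ : (u , c₂) ∈ P
      ∈₃ : (u , c₃) ∈ P
      ∈₄ : (u , c₄) ∈ P
      ∈₅ : (u , c₅) ∈ P
      ∈₆ : (u , c₆) ∈ P

  six-in-row : (cs : List (Fin n)) → AllPairs _<_ cs → All (λ c → (u , c) ∈ P) cs →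
               6 ℕ.≤ length cs → SixInRow P u
  six-in-row (c₁ ∷ c₂ ∷ c₃ ∷ c₄ ∷ c₅ ∷ c₆ ∷ _)
             ((c₁<c₂ ∷ _) ∷ (c₂<c₃ ∷ _) ∷ (c₃<c₄ ∷ _) ∷ (c₄<c₅ ∷ _) ∷ (c₅<c₆ ∷ _) ∷ _)
             (∈₁ ∷ ∈₂ ∷ ∈₃ ∷ ∈₄ ∷ ∈₅ ∷ ∈₆ ∷ _) _ = record
    { c₁ = c₁ ; c₂ = c₂ ; c₃ = c₃ ; c₄ = c₄ ; c₅ = c₅ ; c₆ = c₆
    ; c₁<c₂ = c₁<c₂ ; c₂<c₃ = c₂<c₃ ; c₃<c₄ = c₃<c₄ ; c₄<c₅ = c₄<c₅ ; c₅<c₆ = c₅<c₆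
    ; ∈₁ = ∈₁ ; ∈₂ = ∈₂ ; ∈₃ = ∈₃ ; ∈₄ = ∈₄ ; ∈₅ = ∈₅ ; ∈₆ = ∈₆
    }
  six-in-row [] _ _ ()
  six-in-row (_ ∷ []) _ _ (s≤s ())
  six-in-row (_ ∷ _ ∷ []) _ _ (s≤s (s≤s ()))
  six-in-row (_ ∷ _ ∷ _ ∷ []) _ _ (s≤s (s≤s (s≤s ())))
  six-in-row (_ ∷ _ ∷ _ ∷ _ ∷ []) _ _ (s≤s (s≤s (s≤s (s≤s ()))))
  six-in-row (_ ∷ _ ∷ _ ∷ _ ∷ _ ∷ []) _ _ (s≤s (s≤s (s≤s (s≤s (s≤s ())))))

module Grid {A : Set} (_≺_ : Rel A 0ℓ) (n : ℕ) where
  open Points {A} n public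

  -- The disjuncts of Decreasing are ordered so that for flip _≺_ the two relations swap
  -- definitionally.
  Increasing : Rel Point 0ℓ
  Increasing (a , b) (a′ , b′) = (a ≺ a′ × b < b′) ⊎ (a′ ≺ a × b′ < b)

  Decreasing : Rel Point 0ℓ
  Decreasing (a , b) (a′ , b′) = (a′ ≺ a × b < b′) ⊎ (a ≺ a′ × b′ < b)

  Increasing-sym : Symmetric Increasing
  Increasing-sym = Sum.swap

  Decreasing-sym : Symmetric Decreasing
  Decreasing-sym = Sum.swap

  record Compatible (P Q : Pred Point 0ℓ) (inStack : Point → Bool) : Set where
    field
      stack-ok : ∀ {p q} → p ∈ P → q ∈ Q → inStack p ≡ true → inStack q ≡ true → ¬ Increasing p q
      queue-ok : ∀ {p q} → p ∈ P → q ∈ Q → inStack p ≡ false → inStack q ≡ false → ¬ Decreasing p q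

  IsLayout : Pred Point 0ℓ → (Point → Bool) → Set
  IsLayout P = Compatible P P

  Layout : Pred Point 0ℓ → Set
  Layout P = ∃ (IsLayout P)

  Critical : Pred Point 0ℓ → Set
  Critical P = ¬ Layout P × (∀ {p} → p ∈ P → Layout (P without p))

  record Split (P : Pred Point 0ℓ) (u : A) (c : Fin n) (inStack : Point → Bool) : Set where
    field
      stack-before  : ∀ {x} → (u , x) ∈ P → x < c → inStack (u , x) ≡ true
      queue-after   : ∀ {x} → (u , x) ∈ P → c < x → inStack (u , x) ≡ false
      blocker       : Point
      blocker-∈     : blocker ∈ P without (u , c)
      blocker-queue : inStack blocker ≡ false
      blocker-row   : proj₁ blocker ≺ u
      blocker-col   : c < proj₂ blocker

  open Compatible public

  private variable
    P P₁ P₂ Q : Pred Point 0ℓ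
    col col′ col₁ col₂ : Point → Bool
    f g p q r : Point
    a u : A
    c d l : Fin n

  combine : IsLayout P₁ col₁ → IsLayout P₂ col₂ →
            (∀ {q} → q ∈ Q → col q ≡ true → q ∈ P₁ × col₁ q ≡ true) →
            (∀ {q} → q ∈ Q → col q ≡ false → q ∈ P₂ × col₂ q ≡ false) →
            IsLayout Q col
  combine L₁ L₂ stacks queues = record
    { stack-ok = λ p∈Q q∈Q p-stack q-stack →
        stack-ok L₁ (proj₁ (stacks p∈Q p-stack)) (proj₁ (stacks q∈Q q-stack))
                    (proj₂ (stacks p∈Q p-stack)) (proj₂ (stacks q∈Q q-stack))
    ; queue-ok = λ p∈Q q∈Q p-queue q-queue →
        queue-ok L₂ (proj₁ (queues p∈Q p-queue)) (proj₁ (queues q∈Q q-queue))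
                    (proj₂ (queues p∈Q p-queue)) (proj₂ (queues q∈Q q-queue))
    }

  restrict : (∀ {q} → q ∈ Q → q ∈ P × col′ q ≡ col q) → IsLayout P col → IsLayout Q col′
  restrict agree L = combine L L
    (λ q∈Q e → proj₁ (agree q∈Q) , trans (sym (proj₂ (agree q∈Q))) e)
    (λ q∈Q e → proj₁ (agree q∈Q) , trans (sym (proj₂ (agree q∈Q))) e)

  glue : {S : Pred Point 0ℓ} → Decidable S →
         Compatible (P ∩ S) (P ∖ S) col → IsLayout (P ∩ S) col → IsLayout (P ∖ S) col →
         IsLayout P col
  glue {P} {col} {S} S? across inside outside = record { stack-ok = stacks ; queue-ok = queues }
    where
    stacks : p ∈ P → q ∈ P → col p ≡ true → col q ≡ true → ¬ Increasing p q
    stacks {p} {q} p∈P q∈P with S? p | S? q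
    ... | yes p∈S | yes q∈S = stack-ok inside (p∈P , p∈S) (q∈P , q∈S)
    ... | yes p∈S | no  q∉S = stack-ok across (p∈P , p∈S) (q∈P , q∉S)
    ... | no  p∉S | yes q∈S = λ ps qs →
      stack-ok across (q∈P , q∈S) (p∈P , p∉S) qs ps ∘ Increasing-sym
    ... | no  p∉S | no  q∉S = stack-ok outside (p∈P , p∉S) (q∈P , q∉S)
    queues : p ∈ P → q ∈ P → col p ≡ false → col q ≡ false → ¬ Decreasing p q
    queues {p} {q} p∈P q∈P with S? p | S? q
    ... | yes p∈S | yes q∈S = queue-ok inside (p∈P , p∈S) (q∈P , q∈S)
    ... | yes p∈S | no  q∉S = queue-ok across (p∈P , p∈S) (q∈P , q∉S)
    ... | no  p∉S | yes q∈S = λ pq qq →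
      queue-ok across (q∈P , q∈S) (p∈P , p∉S) qq pq ∘ Decreasing-sym
    ... | no  p∉S | no  q∉S = queue-ok outside (p∈P , p∉S) (q∈P , q∉S)

  same-row : Irreflexive _≡_ _≺_ → (∀ {q} → q ∈ Q → proj₁ q ≡ a) → IsLayout Q col
  same-row {Q = Q} irrefl on-row = record
    { stack-ok = λ where p∈Q q∈Q _ _ (inj₁ (p≺q , _)) → irrefl (same p∈Q q∈Q) p≺q
                         p∈Q q∈Q _ _ (inj₂ (q≺p , _)) → irrefl (same q∈Q p∈Q) q≺p
    ; queue-ok = λ where p∈Q q∈Q _ _ (inj₁ (q≺p , _)) → irrefl (same q∈Q p∈Q) q≺p
                         p∈Q q∈Q _ _ (inj₂ (p≺q , _)) → irrefl (same p∈Q q∈Q) p≺q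
    }
    where
    same : p ∈ Q → q ∈ Q → proj₁ p ≡ proj₁ q
    same p∈Q q∈Q = trans (on-row p∈Q) (sym (on-row q∈Q))

  module _ {P : Pred Point 0ℓ} {col : Point → Bool} (L : IsLayout P col) where

    forced-queue : p ∈ P → q ∈ P → col q ≡ true → Increasing p q → col p ≡ false
    forced-queue {p} p∈P q∈P q-stack p↗q with col p in eq
    ... | true  = ⊥-elim (stack-ok L p∈P q∈P eq q-stack p↗q)
    ... | false = refl

    forced-stack : p ∈ P → q ∈ P → col q ≡ false → Decreasing p q → col p ≡ true
    forced-stack {p} p∈P q∈P q-queue p↘q with col p in eq
    ... | true  = refl
    ... | false = ⊥-elim (queue-ok L p∈P q∈P eq q-queue p↘q)

    uncolourable : p ∈ P → q ∈ P → col q ≡ true → Increasing p q →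
                   r ∈ P → col r ≡ false → Decreasing p r → ⊥
    uncolourable p∈P q∈P q-stack p↗q r∈P r-queue p↘r
      with () ← trans (sym (forced-stack p∈P r∈P r-queue p↘r)) (forced-queue p∈P q∈P q-stack p↗q)

  blockers⇒split : IsLayout (P without (u , c)) col → (u , l) ∈ P → l < c →
          f ∈ P without (u , c) → col f ≡ true → Increasing (u , c) f →
          g ∈ P without (u , c) → col g ≡ false → proj₁ g ≺ u → c < proj₂ g →
          Split P u c col
  blockers⇒split L ul∈P l<c f∈ f-stack (inj₁ (u≺f , c<f)) g∈ g-queue g≺u c<g =
    ⊥-elim (uncolourable L (ul∈P , ∉-col (Finₚ.<⇒≢ l<c))
                         f∈ f-stack (inj₁ (u≺f , Finₚ.<-trans l<c c<f))
                         g∈ g-queue (inj₁ (g≺u , Finₚ.<-trans l<c c<g)))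
  blockers⇒split L _ _ f∈ f-stack (inj₂ (f≺u , f<c)) g∈ g-queue g≺u c<g = record
    { stack-before  = λ ux∈P x<c → forced-stack L (ux∈P , ∉-col (Finₚ.<⇒≢ x<c))
                                     g∈ g-queue (inj₁ (g≺u , Finₚ.<-trans x<c c<g))
    ; queue-after   = λ ux∈P c<x → forced-queue L (ux∈P , ∉-col (≢-sym (Finₚ.<⇒≢ c<x)))
                                     f∈ f-stack (inj₂ (f≺u , Finₚ.<-trans f<c c<x))
    ; blocker       = _
    ; blocker-∈     = g∈
    ; blocker-queue = g-queue
    ; blocker-row   = g≺u
    ; blocker-col   = c<g
    }

  blocker-col-≤ : IsLayout (P without (u , c)) col → (s : Split P u c col) →
                  (u , d) ∈ P → c < d → proj₂ (Split.blocker s) ≤ d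
  blocker-col-≤ L s ud∈P c<d = ℕₚ.≮⇒≥ λ d<blocker →
    queue-ok L (ud∈P , ∉-col (≢-sym (Finₚ.<⇒≢ c<d))) blocker-∈
               (queue-after ud∈P c<d) blocker-queue (inj₁ (blocker-row , d<blocker))
    where open Split s

module _ {A : Set} {_≺_ : Rel A 0ℓ} {n : ℕ} where
  open Grid _≺_ n
  private module Op = Grid (flip _≺_) n

  reverse : ∀ {P Q col} → Compatible P Q col → Op.Compatible P Q (not ∘ col)
  reverse C = record
    { stack-ok = λ p∈P q∈Q p-stack q-stack →
        queue-ok C p∈P q∈Q (not-injective p-stack) (not-injective q-stack)
    ; queue-ok = λ p∈P q∈Q p-queue q-queue →
        stack-ok C p∈P q∈Q (not-injective p-queue) (not-injective q-queue)
    }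

  reverse-layout : ∀ {P} → Layout P → Op.Layout P
  reverse-layout = Product.map (not ∘_) reverse

module Order {A : Set} {_≺_ : Rel A 0ℓ} (≺-sto : IsStrictTotalOrder _≡_ _≺_) (n : ℕ) where
  open Grid _≺_ n
  open IsStrictTotalOrder ≺-sto using (compare; irrefl; asym)
    renaming (trans to ≺-trans; _<?_ to _≺?_; _≟_ to _≟ʳ_)

  private variable
    P : Pred Point 0ℓ
    col col₂ col₅ : Point → Bool
    p : Point
    a u : A
    b : Fin n

  ≺⇒≢ : a ≺ u → a ≢ u
  ≺⇒≢ a≺u refl = irrefl refl a≺u

  ≻⇒≢ : u ≺ a → a ≢ u
  ≻⇒≢ u≺a refl = irrefl refl u≺a

  ⊀⇒≡⊎≻ : ¬ a ≺ u → a ≡ u ⊎ u ≺ a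
  ⊀⇒≡⊎≻ {a} {u} a⊀u with compare a u
  ... | tri< a≺u _ _ = ⊥-elim (a⊀u a≺u)
  ... | tri≈ _ a≡u _ = inj₁ a≡u
  ... | tri> _ _ u≺a = inj₂ u≺a

  ⊀∧≢⇒≻ : ¬ a ≺ u → a ≢ u → u ≺ a
  ⊀∧≢⇒≻ a⊀u a≢u = Sum.[ ⊥-elim ∘ a≢u , id ] (⊀⇒≡⊎≻ a⊀u)

  _≟ₚ_ : DecidableEquality Point
  _≟ₚ_ = ≡-dec _≟ʳ_ Fin._≟_

  extend-stack : IsLayout (P without p) col →
                 (∀ {q} → q ∈ P without p → col q ≡ true → ¬ Increasing p q) → Layout P
  extend-stack {P} {p} {col} L free =
    colour , glue (p ≟ₚ_) across (same-row irrefl at-p) (restrict elsewhere L)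
    where
    colour : Point → Bool
    colour q = if does (p ≟ₚ q) then true else col q

    colour-p : colour p ≡ true
    colour-p rewrite dec-true (p ≟ₚ p) refl = refl

    elsewhere : ∀ {q} → q ∈ P without p → q ∈ P without p × colour q ≡ col q
    elsewhere (q∈P , p≢q) rewrite dec-false (p ≟ₚ _) p≢q = (q∈P , p≢q) , refl

    at-p : ∀ {q} → q ∈ P ∩ ｛ p ｝ → proj₁ q ≡ proj₁ p
    at-p (_ , refl) = refl

    across : Compatible (P ∩ ｛ p ｝) (P without p) colour
    across = record
      { stack-ok = λ where
          (_ , refl) q∈ _ q-stack → free q∈ (trans (sym (proj₂ (elsewhere q∈))) q-stack)
      ; queue-ok = λ where
          (_ , refl) _ p-queue _ _ → not-¬ colour-p p-queue
      }

  module _ {P : Pred Point 0ℓ} {u : A} (six : SixInRow P u) where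
    open SixInRow six

    split₂-excludes-reversed-split₅ :
      IsLayout (P without (u , c₂)) col₂ → Split P u c₂ col₂ →
      IsLayout (P without (u , c₅)) col₅ → col₅ (u , c₁) ≡ false → col₅ (u , c₆) ≡ true → ⊥
    split₂-excludes-reversed-split₅ L₂ s₂ L₅ queue₁ stack₆ =
      uncolourable L₅ (proj₁ blocker-∈ , ∉-row (≺⇒≢ blocker-row))
        (∈₆ , ∉-col (≢-sym (Finₚ.<⇒≢ c₅<c₆))) stack₆
        (inj₁ (blocker-row , ℕₚ.≤-<-trans (blocker-col-≤ L₂ s₂ ∈₃ c₂<c₃) c₃<c₆))
        (∈₁ , ∉-col (Finₚ.<⇒≢ c₁<c₅)) queue₁
        (inj₂ (blocker-row , Finₚ.<-trans c₁<c₂ blocker-col))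
      where
      open Split s₂
      c₃<c₆ : c₃ < c₆
      c₃<c₆ = Finₚ.<-trans c₃<c₄ (Finₚ.<-trans c₄<c₅ c₅<c₆)
      c₁<c₅ : c₁ < c₅
      c₁<c₅ = Finₚ.<-trans c₁<c₂ (Finₚ.<-trans c₂<c₃ (Finₚ.<-trans c₃<c₄ c₄<c₅))

    private
      module FromSplits
        (L₂ : IsLayout (P without (u , c₂)) col₂) (s₂ : Split P u c₂ col₂)
        (L₅ : IsLayout (P without (u , c₅)) col₅) (s₅ : Split P u c₅ col₅) where

        stack₁ : col₂ (u , c₁) ≡ true
        stack₁ = Split.stack-before s₂ ∈₁ c₁<c₂

        queue₃ : col₂ (u , c₃) ≡ false
        queue₃ = Split.queue-after s₂ ∈₃ c₂<c₃

        stack₄ : col₅ (u , c₄) ≡ true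
        stack₄ = Split.stack-before s₅ ∈₄ c₄<c₅

        before-stack : a ≺ u → (a , b) ∈ P → c₃ < b → col₂ (a , b) ≡ true
        before-stack a≺u ab∈P c₃<b =
          forced-stack L₂ (ab∈P , ∉-row (≺⇒≢ a≺u)) (∈₃ , ∉-col (≢-sym (Finₚ.<⇒≢ c₂<c₃))) queue₃
            (inj₂ (a≺u , c₃<b))

        before-queue : a ≺ u → (a , b) ∈ P → b ≤ c₃ → col₅ (a , b) ≡ false
        before-queue a≺u ab∈P b≤c₃ =
          forced-queue L₅ (ab∈P , ∉-row (≺⇒≢ a≺u)) (∈₄ , ∉-col (Finₚ.<⇒≢ c₄<c₅)) stack₄
            (inj₁ (a≺u , ℕₚ.≤-<-trans b≤c₃ c₃<c₄))

        after-stack : u ≺ a → (a , b) ∈ P → col₂ (a , b) ≡ true → b ≤ c₁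
        after-stack u≺a ab∈P ab-stack = ℕₚ.≮⇒≥ λ c₁<b →
          stack-ok L₂ (∈₁ , ∉-col (Finₚ.<⇒≢ c₁<c₂)) (ab∈P , ∉-row (≻⇒≢ u≺a)) stack₁ ab-stack
            (inj₁ (u≺a , c₁<b))

        after-queue : u ≺ a → (a , b) ∈ P → col₂ (a , b) ≡ false → c₃ ≤ b
        after-queue u≺a ab∈P ab-queue = ℕₚ.≮⇒≥ λ b<c₃ →
          queue-ok L₂ (∈₃ , ∉-col (≢-sym (Finₚ.<⇒≢ c₂<c₃))) (ab∈P , ∉-row (≻⇒≢ u≺a)) queue₃ ab-queue
            (inj₂ (u≺a , b<c₃))

        -- In rows before u the stack is exactly the part beyond c₃, which makes their stack points
        -- stack points of col₂ and their queue points queue points of col₅.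
        colour : Point → Bool
        colour (a , b) = if does (a ≺? u) then does (c₃ <? b)
                         else if does (a ≟ʳ u) then not (does (c₃ <? b))
                         else col₂ (a , b)

        before-true : a ≺ u → colour (a , b) ≡ true → c₃ < b
        before-true {b = b} a≺u e rewrite dec-true (_ ≺? u) a≺u = does-true (c₃ <? b) e

        before-false : a ≺ u → colour (a , b) ≡ false → b ≤ c₃
        before-false {b = b} a≺u e rewrite dec-true (_ ≺? u) a≺u = ℕₚ.≮⇒≥ (does-false (c₃ <? b) e)

        at-true : colour (u , b) ≡ true → b ≤ c₃
        at-true {b} e rewrite dec-false (u ≺? u) (irrefl refl) | dec-true (u ≟ʳ u) refl =
          ℕₚ.≮⇒≥ (does-false (c₃ <? b) (not-injective e))

        at-false : colour (u , b) ≡ false → c₃ < b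
        at-false {b} e rewrite dec-false (u ≺? u) (irrefl refl) | dec-true (u ≟ʳ u) refl =
          does-true (c₃ <? b) (not-injective e)

        after : u ≺ a → colour (a , b) ≡ col₂ (a , b)
        after u≺a rewrite dec-false (_ ≺? u) (asym u≺a) | dec-false (_ ≟ʳ u) (≻⇒≢ u≺a) = refl

        Before AtU : Pred Point 0ℓ
        Before (a , _) = a ≺ u
        AtU (a , _) = a ≡ u

        upper : IsLayout (P ∩ Before) colour
        upper = combine L₂ L₅
          (λ (ab∈P , a≺u) e → (ab∈P , ∉-row (≺⇒≢ a≺u)) , before-stack a≺u ab∈P (before-true a≺u e))
          (λ (ab∈P , a≺u) e → (ab∈P , ∉-row (≺⇒≢ a≺u)) , before-queue a≺u ab∈P (before-false a≺u e))

        row-u : IsLayout ((P ∖ Before) ∩ AtU) colour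
        row-u = same-row irrefl proj₂

        rows-after : IsLayout ((P ∖ Before) ∖ AtU) colour
        rows-after = restrict
          (λ ((ab∈P , a⊀u) , a≢u) → (ab∈P , ∉-row a≢u) , after (⊀∧≢⇒≻ a⊀u a≢u)) L₂

        row-u-vs-after : Compatible ((P ∖ Before) ∩ AtU) ((P ∖ Before) ∖ AtU) colour
        row-u-vs-after = record { stack-ok = stacks ; queue-ok = queues }
          where
          stacks : ∀ {p q} → p ∈ (P ∖ Before) ∩ AtU → q ∈ (P ∖ Before) ∖ AtU →
                   colour p ≡ true → colour q ≡ true → ¬ Increasing p q
          stacks ((ub∈P , _) , refl) ((q∈P , q⊀u) , q≢u) _ q-stack (inj₁ (u≺a , b<b′)) =
            stack-ok L₂ (ub∈P , ∉-col (Finₚ.<⇒≢ b<c₂)) (q∈P , ∉-row q≢u)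
              (Split.stack-before s₂ ub∈P b<c₂) q-stack₂ (inj₁ (u≺a , b<b′))
            where
            q-stack₂ : col₂ _ ≡ true
            q-stack₂ = trans (sym (after u≺a)) q-stack
            b<c₂ : _ < c₂
            b<c₂ = Finₚ.<-trans (ℕₚ.<-≤-trans b<b′ (after-stack u≺a q∈P q-stack₂)) c₁<c₂
          stacks (_ , refl) ((_ , q⊀u) , _) _ _ (inj₂ (a≺u , _)) = q⊀u a≺u
          queues : ∀ {p q} → p ∈ (P ∖ Before) ∩ AtU → q ∈ (P ∖ Before) ∖ AtU →
                   colour p ≡ false → colour q ≡ false → ¬ Decreasing p q
          queues ((ub∈P , _) , refl) ((q∈P , q⊀u) , q≢u) p-queue q-queue =
            queue-ok L₂ (ub∈P , ∉-col (≢-sym (Finₚ.<⇒≢ c₂<b))) (q∈P , ∉-row q≢u)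
              (Split.queue-after s₂ ub∈P c₂<b) (trans (sym (after (⊀∧≢⇒≻ q⊀u q≢u))) q-queue)
            where
            c₂<b : c₂ < _
            c₂<b = Finₚ.<-trans c₂<c₃ (at-false p-queue)

        lower : IsLayout (P ∖ Before) colour
        lower = glue {S = AtU} (λ (a , _) → a ≟ʳ u) row-u-vs-after row-u rows-after

        lower-stack-≤ : (a , b) ∈ P → ¬ a ≺ u → colour (a , b) ≡ true → b ≤ c₃
        lower-stack-≤ ab∈P a⊀u e with ⊀⇒≡⊎≻ a⊀u
        ... | inj₁ refl = at-true e
        ... | inj₂ u≺a = ℕₚ.≤-trans (after-stack u≺a ab∈P (trans (sym (after u≺a)) e))
                                   (ℕₚ.<⇒≤ (Finₚ.<-trans c₁<c₂ c₂<c₃))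

        lower-queue-≥ : (a , b) ∈ P → ¬ a ≺ u → colour (a , b) ≡ false → c₃ ≤ b
        lower-queue-≥ ab∈P a⊀u e with ⊀⇒≡⊎≻ a⊀u
        ... | inj₁ refl = ℕₚ.<⇒≤ (at-false e)
        ... | inj₂ u≺a = after-queue u≺a ab∈P (trans (sym (after u≺a)) e)

        upper-vs-lower : Compatible (P ∩ Before) (P ∖ Before) colour
        upper-vs-lower = record { stack-ok = stacks ; queue-ok = queues }
          where
          stacks : ∀ {p q} → p ∈ P ∩ Before → q ∈ P ∖ Before →
                   colour p ≡ true → colour q ≡ true → ¬ Increasing p q
          stacks (_ , a≺u) (q∈P , q⊀u) p-stack q-stack (inj₁ (_ , b<b′)) =
            ℕₚ.<⇒≱ (Finₚ.<-trans (before-true a≺u p-stack) b<b′) (lower-stack-≤ q∈P q⊀u q-stack)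
          stacks (_ , a≺u) (_ , q⊀u) _ _ (inj₂ (a′≺a , _)) = q⊀u (≺-trans a′≺a a≺u)
          queues : ∀ {p q} → p ∈ P ∩ Before → q ∈ P ∖ Before →
                   colour p ≡ false → colour q ≡ false → ¬ Decreasing p q
          queues (_ , a≺u) (_ , q⊀u) _ _ (inj₁ (a′≺a , _)) = q⊀u (≺-trans a′≺a a≺u)
          queues (_ , a≺u) (q∈P , q⊀u) p-queue q-queue (inj₂ (_ , b′<b)) =
            ℕₚ.<⇒≱ (ℕₚ.<-≤-trans b′<b (before-false a≺u p-queue)) (lower-queue-≥ q∈P q⊀u q-queue)

        layout : IsLayout P colour
        layout = glue {S = Before} (λ (a , _) → a ≺? u) upper-vs-lower upper lower

    layout-from-splits : IsLayout (P without (u , c₂)) col₂ → Split P u c₂ col₂ →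
                         IsLayout (P without (u , c₅)) col₅ → Split P u c₅ col₅ → Layout P
    layout-from-splits L₂ s₂ L₅ s₅ = _ , FromSplits.layout L₂ s₂ L₅ s₅

module BothOrders {A : Set} {_≺_ : Rel A 0ℓ} (≺-sto : IsStrictTotalOrder _≡_ _≺_) (n : ℕ) where
  open Grid _≺_ n
  private
    module ≺ = Order ≺-sto n
    module ≻ = Order (Flip.isStrictTotalOrder ≺-sto) n
    module Op = Grid (flip _≺_) n

  private variable
    P : Pred Point 0ℓ
    col : Point → Bool
    p : Point
    u : A
    c l r : Fin n

  extend-queue : IsLayout (P without p) col →
                 (∀ {q} → q ∈ P without p → col q ≡ false → ¬ Decreasing p q) → Layout P
  extend-queue L free =
    reverse-layout (≻.extend-stack (reverse L) λ q∈ q-queue → free q∈ (not-injective q-queue))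

  -- (u , c) fits neither into the stack nor into the queue of L; the positions of the two
  -- blocking points give the direction of the split, and (u , r) rules out that both lie
  -- in columns before c.
  split-or-reversed-split : ¬ Layout P → IsLayout (P without (u , c)) col →
                            (u , l) ∈ P → l < c → (u , r) ∈ P → c < r →
                            ¬ ¬ (Split P u c col ⊎ Op.Split P u c (not ∘ col))
  split-or-reversed-split {P} {u} {c} {col} no-layout L ul∈P l<c ur∈P c<r no-split =
    no-layout (≺.extend-stack L λ f∈ f-stack u↗f →
    no-layout (extend-queue L λ g∈ g-queue u↘g → blocked f∈ f-stack u↗f g∈ g-queue u↘g))
    where
    blocked : ∀ {f g} → f ∈ P without (u , c) → col f ≡ true → Increasing (u , c) f →
              g ∈ P without (u , c) → col g ≡ false → Decreasing (u , c) g → ⊥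
    blocked f∈ f-stack u↗f g∈ g-queue (inj₁ (g≺u , c<g)) =
      no-split (inj₁ (blockers⇒split L ul∈P l<c f∈ f-stack u↗f g∈ g-queue g≺u c<g))
    blocked f∈ f-stack (inj₁ (u≺f , c<f)) g∈ g-queue u↘g@(inj₂ _) =
      no-split (inj₂ (Op.blockers⇒split (reverse L) ul∈P l<c g∈ (cong not g-queue) u↘g
                                        f∈ (cong not f-stack) u≺f c<f))
    blocked f∈ f-stack (inj₂ (f≺u , f<c)) g∈ g-queue (inj₂ (u≺g , g<c)) =
      uncolourable L (ur∈P , ∉-col (≢-sym (Finₚ.<⇒≢ c<r)))
        f∈ f-stack (inj₂ (f≺u , Finₚ.<-trans f<c c<r))
        g∈ g-queue (inj₂ (u≺g , Finₚ.<-trans g<c c<r))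

  no-six-in-row : Critical P → ¬ SixInRow P u
  no-six-in-row {P} {u} (no-layout , layout-without) six =
    split-or-reversed-split no-layout L₂ ∈₁ c₁<c₂ ∈₃ c₂<c₃ λ s₂ →
    split-or-reversed-split no-layout L₅ ∈₄ c₄<c₅ ∈₆ c₅<c₆ λ s₅ → incompatible s₂ s₅
    where
    open SixInRow six
    col₂ col₅ : Point → Bool
    col₂ = proj₁ (layout-without ∈₂)
    col₅ = proj₁ (layout-without ∈₅)
    L₂ : IsLayout (P without (u , c₂)) col₂
    L₂ = proj₂ (layout-without ∈₂)
    L₅ : IsLayout (P without (u , c₅)) col₅
    L₅ = proj₂ (layout-without ∈₅)
    c₁<c₅ : c₁ < c₅
    c₁<c₅ = Finₚ.<-trans c₁<c₂ (Finₚ.<-trans c₂<c₃ (Finₚ.<-trans c₃<c₄ c₄<c₅))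
    incompatible : Split P u c₂ col₂ ⊎ Op.Split P u c₂ (not ∘ col₂) →
                   Split P u c₅ col₅ ⊎ Op.Split P u c₅ (not ∘ col₅) → ⊥
    incompatible (inj₁ s₂) (inj₁ s₅) = no-layout (≺.layout-from-splits six L₂ s₂ L₅ s₅)
    incompatible (inj₂ s₂) (inj₂ s₅) =
      no-layout (reverse-layout (≻.layout-from-splits six (reverse L₂) s₂ (reverse L₅) s₅))
    incompatible (inj₁ s₂) (inj₂ s₅) =
      ≺.split₂-excludes-reversed-split₅ six L₂ s₂ L₅
        (not-injective (Op.Split.stack-before s₅ ∈₁ c₁<c₅))
        (not-injective (Op.Split.queue-after s₅ ∈₆ c₅<c₆))
    incompatible (inj₂ s₂) (inj₁ s₅) =
      ≻.split₂-excludes-reversed-split₅ six (reverse L₂) s₂ (reverse L₅)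
        (cong not (Split.stack-before s₅ ∈₁ c₁<c₅))
        (cong not (Split.queue-after s₅ ∈₆ c₅<c₆))

  fewer-than-six-in-row : Critical P → (cs : List (Fin n)) → AllPairs _<_ cs →
                          All (λ c → (u , c) ∈ P) cs → length cs ℕ.< 6
  fewer-than-six-in-row critical cs sorted in-row =
    ℕₚ.≰⇒> λ six≤ → no-six-in-row critical (six-in-row cs sorted in-row six≤)

module Square (n : ℕ) where
  open Grid {Fin n} _<_ n

  private variable
    P : Pred Point 0ℓ
    col : Point → Bool

  transpose : IsLayout P col → IsLayout (P ∘ swap) (col ∘ swap)
  transpose L = record
    { stack-ok = λ p∈P q∈P p-stack q-stack →
        stack-ok L p∈P q∈P p-stack q-stack ∘ Sum.map swap swap
    ; queue-ok = λ p∈P q∈P p-queue q-queue →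
        queue-ok L p∈P q∈P p-queue q-queue ∘ Sum.swap ∘ Sum.map swap swap
    }

  transpose-critical : Critical P → Critical (P ∘ swap)
  transpose-critical (no-layout , layout-without) =
    (λ (col , L) → no-layout (col ∘ swap , transpose L)) ,
    λ p∈P → Product.map (_∘ swap)
                        (restrict (λ (q∈P , p≢q) → (q∈P , p≢q ∘ cong swap) , refl) ∘ transpose)
                        (layout-without p∈P)

edges : ∀ {n} → OGraph n → Pred (Fin n × Fin n) 0ℓ
edges E (u , v) = IsEdge E u v

module Graphs {n : ℕ} (E : OGraph n) where
  open Grid {Fin n} _<_ n

  private variable
    u v x y : Fin n

  cross⇒increasing : Cross u v x y → Increasing (u , v) (x , y)
  cross⇒increasing = Sum.map (λ (u<x , _ , v<y) → u<x , v<y) (λ (x<u , _ , y<v) → x<u , y<v)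

  nest⇒decreasing : Nest u v x y → Decreasing (u , v) (x , y)
  nest⇒decreasing =
    Sum.swap ∘ Sum.map (λ (u<x , _ , y<v) → u<x , y<v) (λ (x<u , _ , v<y) → x<u , v<y)

  increasing⇒cross : Separated E → IsEdge E u v → IsEdge E x y →
                     Increasing (u , v) (x , y) → Cross u v x y
  increasing⇒cross {u} {v} {x} {y} (_ , separated) uv xy (inj₁ (u<x , v<y)) =
    inj₁ (u<x , ℕₚ.<-≤-trans (proj₁ (separated x y xy)) (proj₂ (separated u v uv)) , v<y)
  increasing⇒cross {u} {v} {x} {y} (_ , separated) uv xy (inj₂ (x<u , y<v)) =
    inj₂ (x<u , ℕₚ.<-≤-trans (proj₁ (separated u v uv)) (proj₂ (separated x y xy)) , y<v)

  decreasing⇒nest : IsEdge E u v → IsEdge E x y → Decreasing (u , v) (x , y) → Nest u v x y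
  decreasing⇒nest (u<v , _) _ (inj₁ (x<u , v<y)) = inj₂ (x<u , u<v , v<y)
  decreasing⇒nest _ (x<y , _) (inj₂ (u<x , y<v)) = inj₁ (u<x , x<y , y<v)

  layout⇒layout11 : ∀ {col} → IsLayout (edges E) col → Layout11 E
  layout⇒layout11 {col} L = record
    { inStack = Product.curry col
    ; stackOK = λ u v x y uv xy uv-stack xy-stack →
        stack-ok L {u , v} {x , y} uv xy uv-stack xy-stack ∘ cross⇒increasing
    ; queueOK = λ u v x y uv xy uv-queue xy-queue →
        queue-ok L {u , v} {x , y} uv xy uv-queue xy-queue ∘ nest⇒decreasing
    }

  layout11⇒layout : Separated E → (L : Layout11 E) →
                    IsLayout (edges E) (Product.uncurry (Layout11.inStack L))
  layout11⇒layout sep L = record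
    { stack-ok = λ {p} {q} p∈ q∈ p-stack q-stack →
        Layout11.stackOK L _ _ _ _ p∈ q∈ p-stack q-stack ∘ increasing⇒cross sep p∈ q∈
    ; queue-ok = λ {p} {q} p∈ q∈ p-queue q-queue →
        Layout11.queueOK L _ _ _ _ p∈ q∈ p-queue q-queue ∘ decreasing⇒nest p∈ q∈
    }

  deleteEdge-⊆ : edges (deleteEdge E u v) ⊆ edges E
  deleteEdge-⊆ (x<y , kept) = x<y , to T-≡ (proj₁ (to T-∧ (from T-≡ kept)))

  without⊆deleteEdge : edges E without (u , v) ⊆ edges (deleteEdge E u v)
  without⊆deleteEdge {u} {v} {x , y} ((x<y , xy) , uv≢xy) = x<y , kept
    where
    kept : E x y ∧ not (⌊ x Fin.≟ u ⌋ ∧ ⌊ y Fin.≟ v ⌋) ≡ true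
    kept rewrite xy with x Fin.≟ u | y Fin.≟ v
    ... | yes refl | yes refl = ⊥-elim (uv≢xy refl)
    ... | yes _    | no _     = refl
    ... | no _     | _        = refl

  deleteEdge-separated : Separated E → Separated (deleteEdge E u v)
  deleteEdge-separated (k , separated) = k , λ x y xy → separated x y (deleteEdge-⊆ xy)

module _ {n : ℕ} {E : OGraph n} where
  open Grid {Fin n} _<_ n
  open Graphs

  critical11⇒critical : Separated E → Critical11 E → Critical (edges E)
  critical11⇒critical sep (no-layout11 , layout11-without) =
    (λ (_ , L) → no-layout11 (layout⇒layout11 E L)) ,
    λ {(u , v)} uv → _ , restrict (λ q∈ → without⊆deleteEdge E q∈ , refl)
                           (layout11⇒layout (deleteEdge E u v) (deleteEdge-separated E sep)
                                            (layout11-without u v uv))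

neighbours : ∀ {n} → OGraph n → Fin n → List (Fin n)
neighbours {n} E v = filter (λ w → adj E v w Bool.≟ true) (allFin n)

module _ {n : ℕ} (E : OGraph n) (v : Fin n) where

  neighbours-sorted : AllPairs _<_ (neighbours E v)
  neighbours-sorted = AllPairsₚ.filter⁺ _ (AllPairsₚ.tabulate⁺-< id)

  neighbours-adjacent : All (λ w → adj E v w ≡ true) (neighbours E v)
  neighbours-adjacent = Allₚ.all-filter _ (allFin n)

adj⇒edge : ∀ {n} {E : OGraph n} {v w} → adj E v w ≡ true → IsEdge E v w ⊎ IsEdge E w v
adj⇒edge {E = E} adjacent = Sum.map edge edge (to T-∨ (from T-≡ adjacent))
  where
  edge : ∀ {x y} → T (⌊ x <? y ⌋ ∧ E x y) → IsEdge E x y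
  edge {x} {y} t with to (T-∧ {⌊ x <? y ⌋} {E x y}) t
  ... | x<y , xy = toWitness x<y , to T-≡ xy

module _ {n : ℕ} {E : OGraph n} (sep : Separated E) {v w : Fin n} where

  edge-from-V₁ : toℕ v ℕ.< proj₁ sep → adj E v w ≡ true → IsEdge E v w
  edge-from-V₁ v∈V₁ adjacent with adj⇒edge {E = E} adjacent
  ... | inj₁ vw = vw
  ... | inj₂ wv = ⊥-elim (ℕₚ.<⇒≱ v∈V₁ (proj₂ (proj₂ sep w v wv)))

  edge-into-V₂ : ¬ toℕ v ℕ.< proj₁ sep → adj E v w ≡ true → IsEdge E w v
  edge-into-V₂ v∉V₁ adjacent with adj⇒edge {E = E} adjacent
  ... | inj₁ vw = ⊥-elim (v∉V₁ (proj₁ (proj₂ sep v w vw)))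
  ... | inj₂ wv = wv

lemma23 : ∀ (n : ℕ) (E : OGraph n) → Separated E → Critical11 E → MaxDegreeLess E 6
lemma23 n E sep crit v = by-side (toℕ v ℕ.<? proj₁ sep)
  where
  open BothOrders Finₚ.<-isStrictTotalOrder n
  open Square n

  critical : Grid.Critical _<_ n (edges E)
  critical = critical11⇒critical sep crit

  by-side : Dec (toℕ v ℕ.< proj₁ sep) → degree E v ℕ.< 6
  by-side (yes v∈V₁) =
    fewer-than-six-in-row critical (neighbours E v) (neighbours-sorted E v)
      (All.map (edge-from-V₁ sep v∈V₁) (neighbours-adjacent E v))
  by-side (no v∉V₁) =
    fewer-than-six-in-row (transpose-critical critical) (neighbours E v) (neighbours-sorted E v)
      (All.map (edge-into-V₂ sep v∉V₁) (neighbours-adjacent E v))
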